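{- For any statement $s$ and state predicates $U,Z$, if $\{U\}\,s\,\{Z\}$ is derivable in the state-based total-correctness Hoare logic with the rule while-fun, then for every state predicate $W$, $\{U\wedge W\}\,s\,\{\langle W\rangle\ast\ast\mathit{finite}\ast\ast\langle Z\rangle\}$ is derivable in the trace-based Hoare logic.
   Context: While statements: $s ::= x:=e \mid \mathsf{skip}\mid s_0;s_1\mid \mathsf{if}\ e\ \mathsf{then}\ s_t\ \mathsf{else}\ s_f\mid \mathsf{while}\ e\ \mathsf{do}\ s_t$; a state $\sigma$ assigns integers to variables, $[\![e]\!]\sigma$ is the value of $e$, $\sigma\models e$ means $e$ is true in $\sigma$. The metatheory is constructive. Traces are coinductive: $\langle\sigma\rangle$, and $\sigma::\tau$ for a trace $\tau$; bisimilarity $\approx$ is coinductive; $\mathit{hd}\langle\sigma\rangle=\mathit{hd}(\sigma::\tau)=\sigma$; $\tau\downarrow\sigma$ is inductive: $\langle\sigma\rangle\downarrow\sigma$, $\sigma::\tau\downarrow\sigma'$ if $\tau\downarrow\sigma'$. State predicates are arbitrary; trace predicates are setoid predicates (invariant under $\approx$); $\mathsf{true},\wedge,\neg,\exists$ are pointwise; $\models$ is entailment; $\mathit{finite}$ holds of $\tau$ iff $\tau\downarrow\sigma$ for some $\sigma$. $\langle U\rangle$ holds exactly of $\langle\sigma\rangle$ with $\sigma\models U$; $\mathrm{dup}(U)$ exactly of $\sigma::\langle\sigma\rangle$ with $\sigma\models U$; $U[x\mapsto e]$ exactly of $\sigma::\langle\sigma[x\mapsto[\![e]\!]\sigma]\rangle$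 with $\sigma\models U$. $\mathrm{follows}_Q(\tau,\tau')$ is coinductive: $\mathrm{follows}_Q(\langle\sigma\rangle,\tau)$ if $\mathit{hd}\,\tau=\sigma$ and $\tau\models Q$; $\mathrm{follows}_Q(\sigma::\tau,\sigma::\tau')$ if $\mathrm{follows}_Q(\tau,\tau')$. $\tau'\models P\ast\ast Q$ iff $\exists\tau$, $\tau\models P$ and $\mathrm{follows}_Q(\tau,\tau')$ (chains associate to the right). $P^{\dagger}$ is coinductive: $\tau\models P^{\dagger}$ if $\tau\models\langle\mathsf{true}\rangle$; $\tau'\models P^{\dagger}$ if $\exists\tau$, $\tau\models P$ and $\mathrm{follows}_{P^{\dagger}}(\tau,\tau')$. The trace-based Hoare logic derives $\{U\}\,s\,\{P\}$ inductively by: $\{U\}\,x:=e\,\{U[x\mapsto e]\}$; $\{U\}\,\mathsf{skip}\,\{\langle U\rangle\}$; from $\{U\}\,s_0\,\{P\ast\ast\langle V\rangle\}$ and $\{V\}\,s_1\,\{Q\}$ infer $\{U\}\,s_0;s_1\,\{P\ast\ast Q\}$; from $\{e\wedge U\}\,s_t\,\{P\}$ and $\{\neg e\wedge U\}\,s_f\,\{P\}$ infer $\{U\}\,\mathsf{if}\ e\ \mathsf{then}\ s_t\ \mathsf{else}\ s_f\,\{\mathrm{dup}(U)\ast\ast P\}$; from $U\models I$ and $\{e\wedge I\}\,s_t\,\{P\ast\ast\langle I\rangle\}$ infer $\{U\}\,\mathsf{while}\ e\ \mathsf{do}\ s_t\,\{\mathrm{dup}(U)\ast\ast(P\ast\ast\mathrm{dup}(I))^{\dagger}\ast\ast\langle\neg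 e\rangle\}$; from $U\models U'$, $\{U'\}\,s\,\{P'\}$, $P'\models P$ infer $\{U\}\,s\,\{P\}$; from $\forall z.\ \{U_z\}\,s\,\{P_z\}$ infer $\{\exists z.U_z\}\,s\,\{\exists z.P_z\}$. The state-based total-correctness Hoare logic with while-fun derives $\{U\}\,s\,\{Z\}$ inductively by: $\{U[e/x]\}\,x:=e\,\{U\}$ where $U[e/x]$ holds of $\sigma$ iff $U$ holds of $\sigma[x\mapsto[\![e]\!]\sigma]$; $\{U\}\,\mathsf{skip}\,\{U\}$; sequence: from $\{U\}\,s_0\,\{V\}$, $\{V\}\,s_1\,\{Z\}$ infer $\{U\}\,s_0;s_1\,\{Z\}$; conditional: from $\{e\wedge U\}\,s_t\,\{Z\}$, $\{\neg e\wedge U\}\,s_f\,\{Z\}$ infer $\{U\}\,\mathsf{if}\ e\ \mathsf{then}\ s_t\ \mathsf{else}\ s_f\,\{Z\}$; while-fun: for a function $t$ from states to natural numbers and $m\in\mathbb{N}$, from $\forall n\in\mathbb{N}.\ \{e\wedge I\wedge t=n\}\,s_t\,\{I\wedge t<n\}$ infer $\{I\wedge t=m\}\,\mathsf{while}\ e\ \mathsf{do}\ s_t\,\{I\wedge t\le m\wedge\neg e\}$ (here $t=n$ etc. are state predicates); from $\forall z.\{U_z\}\,s\,\{V_z\}$ infer $\{\exists z.U_z\}\,s\,\{\exists z.V_z\}$; consequence: from $U\models U'$, $\{U'\}\,s\,\{Z'\}$, $Z'\models Z$ infer $\{U\}\,s\,\{Z\}$. -}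

module Defs where

open import Data.Nat using (ℕ; _<_; _≤_) renaming (_≟_ to _≟ℕ_)
open import Data.Integer using (ℤ)
open import Data.Bool using (Bool; true)
open import Data.Product using (Σ; _×_; _,_; proj₁; proj₂)
open import Data.Sum using (_⊎_; inj₁; inj₂)
open import Level using (Lift; lift; lower) renaming (suc to lsuc; zero to lzero)
open import Data.Unit using (⊤; tt)
open import Data.Empty using (⊥; ⊥-elim)
open import Relation.Nullary using (¬_; yes; no)
open import Relation.Binary.PropositionalEquality using (_≡_; refl; trans; sym; cong; subst)

Var : Set
Var = ℕ

State : Set
State = Var → ℤ

-- Expressions are taken semantically: an arithmetic expression is given by
-- its value [[e]]σ, a boolean expression by its truth value in σ.
AExp : Set
AExp = State → ℤ

BExp : Set
BExp = State → Bool

⟦_⟧ : AExp → State → ℤ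
⟦ e ⟧ σ = e σ

_⊨ₑ_ : State → BExp → Set
σ ⊨ₑ e = e σ ≡ true

_[_↦_] : State → Var → ℤ → State
(σ [ x ↦ v ]) y with y ≟ℕ x
... | yes _ = v
... | no _ = σ y

data Stmt : Set where
  _≔_ : Var → AExp → Stmt
  skip : Stmt
  _⨾_ : Stmt → Stmt → Stmt
  if_then_else_ : BExp → Stmt → Stmt → Stmt
  while_do′_ : BExp → Stmt → Stmt

SPred : Set₁
SPred = State → Set

expₛ : BExp → SPred
expₛ e σ = σ ⊨ₑ e

¬ₛ_ : SPred → SPred
(¬ₛ U) σ = ¬ U σ

_∧ₛ_ : SPred → SPred → SPred
(U ∧ₛ V) σ = U σ × V σ

∃ₛ : {Z : Set} → (Z → SPred) → SPred
∃ₛ {Z} U σ = Σ Z (λ z → U z σ)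

_⊨ₛ_ : SPred → SPred → Set
U ⊨ₛ V = ∀ σ → U σ → V σ

-- The coinductive TYPE of traces is still a
-- coinductive record; the coinductive PREDICATES/RELATIONS (bisimilarity,
-- follows, dagger) are defined as greatest fixed points à la Knaster–Tarski:
-- they hold iff they are witnessed by some post-fixed point (a
-- (bi)simulation-style relation).

mutual
  data Trace : Set where
    ⟨_⟩ : State → Trace
    _∷_ : State → ∞Trace → Trace

  record ∞Trace : Set where
    coinductive
    field force : Trace

open ∞Trace public

hd : Trace → State
hd ⟨ σ ⟩ = σ
hd (σ ∷ _) = σ

data _↓_ : Trace → State → Set where
  ↓nil  : ∀ {σ} → ⟨ σ ⟩ ↓ σ
  ↓cons : ∀ {σ t σ'} → force t ↓ σ' → (σ ∷ t) ↓ σ'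

BisimF : (Trace → Trace → Set) → Trace → Trace → Set
BisimF R ⟨ σ ⟩ ⟨ σ' ⟩ = σ ≡ σ'
BisimF R ⟨ _ ⟩ (_ ∷ _) = ⊥
BisimF R (_ ∷ _) ⟨ _ ⟩ = ⊥
BisimF R (σ ∷ t) (σ' ∷ t') = (σ ≡ σ') × R (force t) (force t')

IsBisim : (Trace → Trace → Set) → Set
IsBisim R = ∀ τ τ' → R τ τ' → BisimF R τ τ'

record _≈_ (τ τ' : Trace) : Set₁ where
  constructor bisim
  field
    rel     : Trace → Trace → Set
    isBisim : IsBisim rel
    related : rel τ τ'

hd-resp : ∀ {τ τ'} → τ ≈ τ' → hd τ ≡ hd τ'
hd-resp {⟨ _ ⟩} {⟨ _ ⟩} (bisim R isB r) = isB _ _ r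
hd-resp {⟨ _ ⟩} {_ ∷ _} (bisim R isB r) = ⊥-elim (isB _ _ r)
hd-resp {_ ∷ _} {⟨ _ ⟩} (bisim R isB r) = ⊥-elim (isB _ _ r)
hd-resp {_ ∷ _} {_ ∷ _} (bisim R isB r) = proj₁ (isB _ _ r)

≈-nil-inv : ∀ {σ τ} → ⟨ σ ⟩ ≈ τ → τ ≡ ⟨ σ ⟩
≈-nil-inv {τ = ⟨ _ ⟩} (bisim R isB r) = cong ⟨_⟩ (sym (isB _ _ r))
≈-nil-inv {τ = _ ∷ _} (bisim R isB r) = ⊥-elim (isB _ _ r)

≈-cons-inv : ∀ {σ t τ'} → (σ ∷ t) ≈ τ' →
             Σ ∞Trace (λ t' → (τ' ≡ σ ∷ t') × (force t ≈ force t'))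
≈-cons-inv {τ' = ⟨ _ ⟩} (bisim R isB r) = ⊥-elim (isB _ _ r)
≈-cons-inv {τ' = _ ∷ t'} (bisim R isB r) with isB _ _ r
... | refl , r' = t' , refl , bisim R isB r'

record TPred : Set₂ where
  field
    holds : Trace → Set₁
    resp  : ∀ {τ τ'} → τ ≈ τ' → holds τ → holds τ'

open TPred public

_⊨_ : Trace → TPred → Set₁
τ ⊨ P = holds P τ

_⊨ₜ_ : TPred → TPred → Set₁
P ⊨ₜ Q = ∀ τ → τ ⊨ P → τ ⊨ Q

∃ₜ : {Z : Set} → (Z → TPred) → TPred
∃ₜ {Z} P = record
  { holds = λ τ → Σ Z (λ z → τ ⊨ P z)
  ; resp  = λ { e (z , p) → z , resp (P z) e p } }

data SingR (U : SPred) : Trace → Set₁ where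
  mk : ∀ {σ} → U σ → SingR U ⟨ σ ⟩

⟪_⟫ : SPred → TPred
⟪ U ⟫ = record { holds = SingR U ; resp = r }
  where
  r : ∀ {τ τ'} → τ ≈ τ' → SingR U τ → SingR U τ'
  r e (mk u) = subst (SingR U) (sym (≈-nil-inv e)) (mk u)

trueₛ : SPred
trueₛ _ = ⊤

data DupR (U : SPred) : Trace → Set₁ where
  mk : ∀ {σ t} → force t ≡ ⟨ σ ⟩ → U σ → DupR U (σ ∷ t)

dup : SPred → TPred
dup U = record { holds = DupR U ; resp = r }
  where
  r : ∀ {τ τ'} → τ ≈ τ' → DupR U τ → DupR U τ'
  r e (mk {σ} {t} eq u) with ≈-cons-inv e
  ... | t' , refl , e' = mk (≈-nil-inv (subst (_≈ force t') eq e')) u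

data UpdR (U : SPred) (x : Var) (e : AExp) : Trace → Set₁ where
  mk : ∀ {σ t} → force t ≡ ⟨ σ [ x ↦ ⟦ e ⟧ σ ] ⟩ → U σ → UpdR U x e (σ ∷ t)

_[_↦ₜ_] : SPred → Var → AExp → TPred
U [ x ↦ₜ e ] = record { holds = UpdR U x e ; resp = r }
  where
  r : ∀ {τ τ'} → τ ≈ τ' → UpdR U x e τ → UpdR U x e τ'
  r q (mk {σ} {t} eq u) with ≈-cons-inv q
  ... | t' , refl , q' = mk (≈-nil-inv (subst (_≈ force t') eq q')) u

↓-resp : ∀ {τ τ' σ} → τ ↓ σ → τ ≈ τ' → τ' ↓ σ
↓-resp ↓nil e rewrite ≈-nil-inv e = ↓nil
↓-resp (↓cons p) e with ≈-cons-inv e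
... | t' , refl , e' = ↓cons (↓-resp p e')

finite : TPred
finite = record
  { holds = λ τ → Lift (lsuc lzero) (Σ State (λ σ → τ ↓ σ))
  ; resp  = λ { e (lift (σ , p)) → lift (σ , ↓-resp p e) } }

FollowsF : (Trace → Set₁) → (Trace → Trace → Set) → Trace → Trace → Set₁
FollowsF Q R ⟨ σ ⟩ τ' = (hd τ' ≡ σ) × Q τ'
FollowsF Q R (σ ∷ t) ⟨ _ ⟩ = Lift (lsuc lzero) ⊥
FollowsF Q R (σ ∷ t) (σ' ∷ t') = Lift (lsuc lzero) ((σ ≡ σ') × R (force t) (force t'))

IsFollows : (Trace → Set₁) → (Trace → Trace → Set) → Set₁
IsFollows Q R = ∀ τ τ' → R τ τ' → FollowsF Q R τ τ'

record Follows (Q : Trace → Set₁) (τ τ' : Trace) : Set₁ where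
  constructor follows
  field
    rel       : Trace → Trace → Set
    isFollows : IsFollows Q rel
    related   : rel τ τ'

follows-comp : ∀ {Q Q' : Trace → Set₁} (S : Trace → Trace → Set) → IsBisim S →
               (∀ {a b} → S a b → Q a → Q' b) →
               ∀ {τ₀ τ τ'} → Follows Q τ₀ τ → S τ τ' → Follows Q' τ₀ τ'
follows-comp {Q} {Q'} S isB g {τ₀} {τ} {τ'} (follows R isF r) s =
  follows R' isF' (τ , r , s)
  where
  R' : Trace → Trace → Set
  R' a c = Σ Trace (λ b → R a b × S b c)
  step : ∀ a b c → FollowsF Q R a b → S b c → FollowsF Q' R' a c
  step ⟨ σ ⟩ b c (h , q) sbc = trans (sym (hd-resp (bisim S isB sbc))) h , g sbc q
  step (σ ∷ t) ⟨ _ ⟩ c (lift ()) sbc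
  step (σ ∷ t) (σ₁ ∷ u) ⟨ _ ⟩ f sbc = ⊥-elim (isB _ _ sbc)
  step (σ ∷ t) (σ₁ ∷ u) (σ₂ ∷ w) (lift (e₁ , ru)) sbc with isB _ _ sbc
  ... | e₂ , su = lift (trans e₁ e₂ , (force u , ru , su))
  isF' : IsFollows Q' R'
  isF' a c (b , rab , sbc) = step a b c (isF a b rab) sbc

follows-resp : ∀ {Q : Trace → Set₁} → (∀ {τ τ'} → τ ≈ τ' → Q τ → Q τ') →
               ∀ {τ₀ τ τ'} → Follows Q τ₀ τ → τ ≈ τ' → Follows Q τ₀ τ'
follows-resp qr f (bisim S isB s) =
  follows-comp S isB (λ sab q → qr (bisim S isB sab) q) f s

_**_ : TPred → TPred → TPred
P ** Q = record
  { holds = λ τ' → Σ Trace (λ τ → (τ ⊨ P) × Follows (holds Q) τ τ')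
  ; resp  = λ { e (τ , p , f) → τ , p , follows-resp (resp Q) f e } }

infixr 5 _**_

DagF : TPred → (Trace → Set) → Trace → Set₁
DagF P D τ' = (τ' ⊨ ⟪ trueₛ ⟫)
            ⊎ Σ Trace (λ τ → (τ ⊨ P) × Follows (λ x → Lift (lsuc lzero) (D x)) τ τ')

record Dag (P : TPred) (τ : Trace) : Set₁ where
  constructor dag
  field
    rel     : Trace → Set
    isDag   : ∀ τ' → rel τ' → DagF P rel τ'
    related : rel τ

dag-resp : ∀ {P τ τ'} → τ ≈ τ' → Dag P τ → Dag P τ'
dag-resp {P} {τ} {τ'} (bisim S isB s) (dag D isD d) = dag D' isD' (τ , d , s)
  where
  D' : Trace → Set
  D' x = Σ Trace (λ y → D y × S y x)
  isD' : ∀ x → D' x → DagF P D' x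
  isD' x (y , dy , syx) with isD y dy
  ... | inj₁ t = inj₁ (resp ⟪ trueₛ ⟫ (bisim S isB syx) t)
  ... | inj₂ (τ₀ , p , f) =
    inj₂ (τ₀ , p , follows-comp S isB (λ {a} {b} sab la → lift (a , lower la , sab)) f syx)

_† : TPred → TPred
P † = record { holds = Dag P ; resp = dag-resp }

infix 6 _†

data ⊢ₜ : SPred → Stmt → TPred → Set₂ where
  assign : ∀ {U x e} → ⊢ₜ U (x ≔ e) (U [ x ↦ₜ e ])
  skip   : ∀ {U} → ⊢ₜ U skip ⟪ U ⟫
  seq    : ∀ {U V s₀ s₁ P Q} →
           ⊢ₜ U s₀ (P ** ⟪ V ⟫) → ⊢ₜ V s₁ Q → ⊢ₜ U (s₀ ⨾ s₁) (P ** Q)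
  if     : ∀ {U e sₜ s_f P} →
           ⊢ₜ (expₛ e ∧ₛ U) sₜ P → ⊢ₜ ((¬ₛ expₛ e) ∧ₛ U) s_f P →
           ⊢ₜ U (if e then sₜ else s_f) (dup U ** P)
  while  : ∀ {U I e sₜ P} →
           U ⊨ₛ I → ⊢ₜ (expₛ e ∧ₛ I) sₜ (P ** ⟪ I ⟫) →
           ⊢ₜ U (while e do′ sₜ) (dup U ** (P ** dup I) † ** ⟪ ¬ₛ expₛ e ⟫)
  conseq : ∀ {U U' s P P'} → U ⊨ₛ U' → ⊢ₜ U' s P' → P' ⊨ₜ P → ⊢ₜ U s P
  ex     : ∀ {Z : Set} {U : Z → SPred} {s} {P : Z → TPred} →
           (∀ z → ⊢ₜ (U z) s (P z)) → ⊢ₜ (∃ₛ U) s (∃ₜ P)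

_[_/_] : SPred → AExp → Var → SPred
(U [ e / x ]) σ = U (σ [ x ↦ ⟦ e ⟧ σ ])

data ⊢ₛ : SPred → Stmt → SPred → Set₁ where
  assign   : ∀ {U x e} → ⊢ₛ (U [ e / x ]) (x ≔ e) U
  skip     : ∀ {U} → ⊢ₛ U skip U
  seq      : ∀ {U V Z s₀ s₁} → ⊢ₛ U s₀ V → ⊢ₛ V s₁ Z → ⊢ₛ U (s₀ ⨾ s₁) Z
  if       : ∀ {U Z e sₜ s_f} →
             ⊢ₛ (expₛ e ∧ₛ U) sₜ Z → ⊢ₛ ((¬ₛ expₛ e) ∧ₛ U) s_f Z →
             ⊢ₛ U (if e then sₜ else s_f) Z
  whilefun : ∀ {I e sₜ} (t : State → ℕ) (m : ℕ) →
             (∀ (n : ℕ) → ⊢ₛ (expₛ e ∧ₛ (I ∧ₛ (λ σ → t σ ≡ n))) sₜ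
                             (I ∧ₛ (λ σ → t σ < n))) →
             ⊢ₛ (I ∧ₛ (λ σ → t σ ≡ m)) (while e do′ sₜ)
                (I ∧ₛ ((λ σ → t σ ≤ m) ∧ₛ (¬ₛ expₛ e)))
  ex       : ∀ {Z : Set} {U V : Z → SPred} {s} →
             (∀ z → ⊢ₛ (U z) s (V z)) → ⊢ₛ (∃ₛ U) s (∃ₛ V)
  conseq   : ∀ {U U' Z Z' s} → U ⊨ₛ U' → ⊢ₛ U' s Z' → Z' ⊨ₛ Z → ⊢ₛ U s Z

module Submission where

open import Defs
open import Data.Nat using (ℕ; _<_; _≤_)
open import Data.Nat.Properties using (≤-reflexive; ≤-trans; <⇒≤)
open import Data.Nat.Induction using (<-wellFounded)
open import Induction.WellFounded using (Acc; acc)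
open import Data.Product using (Σ; _×_; _,_; proj₁; proj₂)
open import Data.Sum using (inj₁; inj₂)
open import Level using (Lift; lift) renaming (suc to lsuc; zero to lzero)
open import Data.Unit using (tt)
open import Relation.Binary.PropositionalEquality using (_≡_; refl; trans; sym; subst; subst₂)

-- The key observation is that ⟨W⟩ ** finite ** ⟨Z⟩ holds of τ exactly when
-- τ starts in a W-state and is finite with last state in Z (spec⇒runs,
-- runs⇒spec).
-- To reason about the chop operator ** we use the suffix order on traces:
-- following a finite trace τ₀ ending in σ leaves a suffix starting in σ
-- (follows-end), which is what lets us compose the translated sub-proofs
-- for sequencing and conditionals.  For while-fun, the invariant I is
-- strengthened by the bound t ≤ m and each body run strictly decreases the
-- variant t; well-founded induction on t then shows that the iteration
-- (P ** dup I)† followed by ⟨¬ e⟩ is finite (dag-terminates).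

Spec : SPred → SPred → TPred
Spec W Z = ⟪ W ⟫ ** finite ** ⟪ Z ⟫

EndsIn : SPred → Trace → Set
EndsIn Z τ = Σ State (λ σ → (τ ↓ σ) × Z σ)

Runs : SPred → SPred → Trace → Set
Runs W Z τ = W (hd τ) × EndsIn Z τ

step-↓ : ∀ {σ t σ'} → force t ≡ ⟨ σ' ⟩ → (σ ∷ t) ↓ σ'
step-↓ eq = ↓cons (subst (_↓ _) (sym eq) ↓nil)

data Suffix : Trace → Trace → Set where
  here  : ∀ {τ} → Suffix τ τ
  there : ∀ {τ σ t} → Suffix τ (force t) → Suffix τ (σ ∷ t)

suffix-trans : ∀ {a b c} → Suffix a b → Suffix b c → Suffix a c
suffix-trans s here       = s
suffix-trans s (there s') = there (suffix-trans s s')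

↓-suffix : ∀ {a b σ} → Suffix a b → a ↓ σ → b ↓ σ
↓-suffix here      p = p
↓-suffix (there s) p = ↓cons (↓-suffix s p)

follows-nil : ∀ {Q σ τ} → Follows Q ⟨ σ ⟩ τ → (hd τ ≡ σ) × Q τ
follows-nil (follows R isF r) = isF _ _ r

follows-cons : ∀ {Q σ t τ} → Follows Q (σ ∷ t) τ →
               Σ ∞Trace (λ w → (τ ≡ σ ∷ w) × Follows Q (force t) (force w))
follows-cons {τ = ⟨ _ ⟩} (follows R isF r) with isF _ _ r
... | lift ()
follows-cons {τ = _ ∷ w} (follows R isF r) with isF _ _ r
... | lift (refl , r') = w , refl , follows R isF r'

follows-hd : ∀ {Q τ τ'} → Follows Q τ τ' → hd τ' ≡ hd τ
follows-hd {τ = ⟨ _ ⟩} f = proj₁ (follows-nil f)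
follows-hd {τ = _ ∷ _} f with follows-cons f
... | _ , refl , _ = refl

follows-self : ∀ {Q : Trace → Set₁} {τ σ} → τ ↓ σ → Q ⟨ σ ⟩ → Follows Q τ τ
follows-self {Q} {τ} {σ} p q = follows R isF (refl , p)
  where
  R : Trace → Trace → Set
  R a b = (a ≡ b) × (a ↓ σ)
  isF : IsFollows Q R
  isF _ _ (refl , ↓nil)    = refl , q
  isF _ _ (refl , ↓cons p') = lift (refl , refl , p')

follows-singleton : ∀ {Q : Trace → Set₁} {τ} → Q τ → Follows Q ⟨ hd τ ⟩ τ
follows-singleton {Q} {τ} q = follows R isF (refl , refl)
  where
  R : Trace → Trace → Set
  R a b = (a ≡ ⟨ hd τ ⟩) × (b ≡ τ)
  isF : IsFollows Q R
  isF _ _ (refl , refl) = refl , q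

follows-end : ∀ {Q τa σ τb} → τa ↓ σ → Follows Q τa τb →
              Σ Trace (λ τc → Q τc × (hd τc ≡ σ) × Suffix τc τb)
follows-end {τb = τb} ↓nil f with follows-nil f
... | h , q = τb , q , h , here
follows-end (↓cons p) f with follows-cons f
... | _ , refl , f' with follows-end p f'
... | τc , q , h , s = τc , q , h , there s

follows-suffix : ∀ {Q τc τb τd} → Suffix τc τb → Follows Q τb τd →
                 Σ Trace (λ τe → Follows Q τc τe × Suffix τe τd)
follows-suffix {τd = τd} here f = τd , f , here
follows-suffix (there s) f with follows-cons f
... | _ , refl , f' with follows-suffix s f'
... | τe , g , s' = τe , g , there s'

spec⇒runs : ∀ {W Z τ} → τ ⊨ Spec W Z → Runs W Z τ
spec⇒runs (⟨ _ ⟩ , mk w , f) with follows-nil f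
... | h , (_ , lift (_ , p) , f₁) with follows-end p f₁
... | _ , mk z , _ , s = subst _ (sym h) w , _ , ↓-suffix s ↓nil , z

runs⇒spec : ∀ {W Z τ} → Runs W Z τ → τ ⊨ Spec W Z
runs⇒spec {τ = τ} (w , σ , p , z) =
  ⟨ hd τ ⟩ , mk w , follows-singleton (τ , lift (σ , p) , follows-self p (mk z))

runs-after-finite : ∀ {Q : Trace → Set₁} {W Z τ₀ σ τ} → τ₀ ↓ σ → W (hd τ₀) →
                    (∀ {τ'} → hd τ' ≡ σ → Q τ' → EndsIn Z τ') →
                    Follows Q τ₀ τ → Runs W Z τ
runs-after-finite {W = W} p w ends f with follows-end p f
... | _ , q , h , s with ends h q
... | σ' , p' , z = subst W (sym (follows-hd f)) w , σ' , ↓-suffix s p' , z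

spec-chop : ∀ {P : TPred} {W Z} →
            (∀ {τ} → τ ⊨ P → Runs W trueₛ τ) →
            (P ** Spec trueₛ Z) ⊨ₜ Spec W Z
spec-chop {W = W} runsP _ (_ , pr , f) with runsP pr
... | w , _ , p , _ =
  runs⇒spec (runs-after-finite {W = W} p w (λ _ sp → proj₂ (spec⇒runs sp)) f)

Decreases : (State → ℕ) → TPred
Decreases t = record
  { holds = λ τ → Lift (lsuc lzero) (Σ State (λ σ → (τ ↓ σ) × (t σ < t (hd τ))))
  ; resp  = λ { e (lift (σ , p , lt)) →
      lift (σ , ↓-resp p e , subst (λ x → t σ < t x) (hd-resp e) lt) } }

Lifted : (Trace → Set) → Trace → Set₁
Lifted D τ = Lift (lsuc lzero) (D τ)

-- I is the loop invariant, F the exit condition and t the variant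
module Iteration (I F : SPred) (t : State → ℕ) where

  iteration-step : ∀ {D : Trace → Set} {τx τ} → τx ⊨ (Decreases t ** dup I) →
                   Follows (Lifted D) τx τ →
                   Σ Trace (λ τ₂ → D τ₂ × I (hd τ₂) × (t (hd τ₂) < t (hd τ)) × Suffix τ₂ τ)
  iteration-step {D} {τ = τ} (_ , lift (σ , p , dec) , fd) f with follows-end p fd
  ... | _ , mk equ i , σd≡σ , s with follows-suffix s f
  ... | _ , f₁ , s₁ with follows-cons f₁
  ... | w , refl , f₂ with follows-nil (subst (λ x → Follows (Lifted D) x (force w)) equ f₂)
  ... | hw≡σd , lift d = force w , d , subst I (sym hw≡σd) i , decrease , suffix-trans (there here) s₁
    where
    decrease : t (hd (force w)) < t (hd τ)
    decrease = subst₂ (λ x y → t x < t y) (sym (trans hw≡σd σd≡σ))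
                 (sym (trans (follows-hd f) (follows-hd fd))) dec

  stop : ∀ {σ τ} → I σ → Follows (SingR F) ⟨ σ ⟩ τ → EndsIn (I ∧ₛ F) τ
  stop i f with follows-nil f
  ... | h , mk φ = _ , ↓nil , subst I (sym h) i , φ

  dag-terminates : ∀ {τ τ'} → Acc _<_ (t (hd τ)) → τ ⊨ ((Decreases t ** dup I) †) →
                   I (hd τ) → Follows (SingR F) τ τ' → EndsIn (I ∧ₛ F) τ'
  dag-terminates (acc rs) (dag D isD d) i f with isD _ d
  ... | inj₁ (mk _) = stop i f
  ... | inj₂ (_ , it , fd) with iteration-step it fd
  ... | τ₂ , d₂ , i₂ , lt , s with follows-suffix s f
  ... | _ , f₂ , s₂ with dag-terminates (rs lt) (dag D isD d₂) i₂ f₂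
  ... | σ' , p , φ = σ' , ↓-suffix s₂ p , φ

Translated : SPred → Stmt → SPred → Set₂
Translated U s Z = ∀ (W : SPred) → ⊢ₜ (U ∧ₛ W) s (Spec W Z)

assign-translated : ∀ {U x e} → Translated (U [ e / x ]) (x ≔ e) U
assign-translated {U} {x} {e} W = conseq (λ _ h → h) assign post
  where
  post : (((U [ e / x ]) ∧ₛ W) [ x ↦ₜ e ]) ⊨ₜ Spec W U
  post _ (mk eq (u , w)) = runs⇒spec (w , _ , step-↓ eq , u)

skip-translated : ∀ {U} → Translated U skip U
skip-translated {U} W = conseq (λ _ h → h) skip post
  where
  post : ⟪ U ∧ₛ W ⟫ ⊨ₜ Spec W U
  post _ (mk (u , w)) = runs⇒spec (w , _ , ↓nil , u)

-- s₀ is run with the extra precondition W, s₁ with none; the chop of the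
-- two runs still starts in W since the first part is finite
seq-translated : ∀ {U V Z s₀ s₁} → Translated U s₀ V → Translated V s₁ Z →
                 Translated U (s₀ ⨾ s₁) Z
seq-translated {U} {V} {Z} {s₀} {s₁} T₀ T₁ W =
  conseq (λ _ h → h) (seq {V = V} {P = Spec W trueₛ} first second)
    (spec-chop {Spec W trueₛ} spec⇒runs)
  where
  first : ⊢ₜ (U ∧ₛ W) s₀ (Spec W trueₛ ** ⟪ V ⟫)
  first = conseq (λ _ h → h) (T₀ W) λ _ sp → case (spec⇒runs sp)
    where
    case : ∀ {τ} → Runs W V τ → τ ⊨ (Spec W trueₛ ** ⟪ V ⟫)
    case {τ} (w , σ , p , v) = τ , runs⇒spec (w , σ , p , tt) , follows-self p (mk v)
  second : ⊢ₜ V s₁ (Spec trueₛ Z)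
  second = conseq (λ _ v → v , tt) (T₁ trueₛ) (λ _ h → h)

-- the branches are run with no extra precondition; W is kept by the
-- initial dup step
if-translated : ∀ {U Z e sₜ s_f} →
                Translated (expₛ e ∧ₛ U) sₜ Z → Translated ((¬ₛ expₛ e) ∧ₛ U) s_f Z →
                Translated U (if e then sₜ else s_f) Z
if-translated {U} Tₜ T_f W =
  conseq (λ _ h → h) (if (branch Tₜ) (branch T_f)) (spec-chop {dup (U ∧ₛ W)} dup-runs)
  where
  branch : ∀ {c s Z} → Translated (c ∧ₛ U) s Z → ⊢ₜ (c ∧ₛ (U ∧ₛ W)) s (Spec trueₛ Z)
  branch T = conseq (λ { _ (c , u , _) → (c , u) , tt }) (T trueₛ) (λ _ h → h)
  dup-runs : ∀ {τ} → τ ⊨ dup (U ∧ₛ W) → Runs W trueₛ τ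
  dup-runs (mk eq (_ , w)) = w , _ , step-↓ eq , tt

-- the body triples, translated with W := Entry n, give the trace body rule
-- with invariant Bounded; termination of the loop is dag-terminates
whilefun-translated : ∀ {I e sₜ} (t : State → ℕ) (m : ℕ) →
  (∀ n → Translated (expₛ e ∧ₛ (I ∧ₛ (λ σ → t σ ≡ n))) sₜ (I ∧ₛ (λ σ → t σ < n))) →
  Translated (I ∧ₛ (λ σ → t σ ≡ m)) (while e do′ sₜ) (I ∧ₛ ((λ σ → t σ ≤ m) ∧ₛ (¬ₛ expₛ e)))
whilefun-translated {I} {e} {sₜ} t m T W =
  conseq (λ _ h → h) (while {I = Bounded} {P = Decreases t} start body) post
  where
  Bounded : SPred
  Bounded σ = I σ × (t σ ≤ m)

  start : ((I ∧ₛ (λ σ → t σ ≡ m)) ∧ₛ W) ⊨ₛ Bounded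
  start _ ((i , t≡m) , _) = i , ≤-reflexive t≡m

  Entry : ℕ → SPred
  Entry n σ = (t σ ≡ n) × (n ≤ m)

  body-post : ∃ₜ (λ n → Spec (Entry n) (I ∧ₛ (λ σ → t σ < n))) ⊨ₜ (Decreases t ** ⟪ Bounded ⟫)
  body-post τ (n , sp) with spec⇒runs sp
  ... | (t≡n , n≤m) , σ , p , i , lt =
    τ , lift (σ , p , subst (t σ <_) (sym t≡n) lt) , follows-self p (mk (i , ≤-trans (<⇒≤ lt) n≤m))

  body : ⊢ₜ (expₛ e ∧ₛ Bounded) sₜ (Decreases t ** ⟪ Bounded ⟫)
  body = conseq (λ { σ (c , i , t≤m) → t σ , (c , i , refl) , refl , t≤m })
                (ex (λ n → T n (Entry n))) body-post

  open Iteration Bounded (¬ₛ expₛ e) t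

  loop-ends : ∀ {σ τ'} → Bounded σ → hd τ' ≡ σ →
              τ' ⊨ ((Decreases t ** dup Bounded) † ** ⟪ ¬ₛ expₛ e ⟫) →
              EndsIn (I ∧ₛ ((λ σ → t σ ≤ m) ∧ₛ (¬ₛ expₛ e))) τ'
  loop-ends b h (_ , dg , f) with dag-terminates (<-wellFounded _) dg
                                    (subst Bounded (sym (trans (sym (follows-hd f)) h)) b) f
  ... | σ' , p , (i , t≤m) , ¬c = σ' , p , i , t≤m , ¬c

  post : (dup ((I ∧ₛ (λ σ → t σ ≡ m)) ∧ₛ W) ** (Decreases t ** dup Bounded) † ** ⟪ ¬ₛ expₛ e ⟫)
         ⊨ₜ Spec W (I ∧ₛ ((λ σ → t σ ≤ m) ∧ₛ (¬ₛ expₛ e)))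
  post _ (_ , mk eq (pre , w) , f) =
    runs⇒spec (runs-after-finite {W = W} (step-↓ eq) w (loop-ends (start _ (pre , w))) f)

ex-translated : ∀ {A : Set} {U V : A → SPred} {s} →
                (∀ z → Translated (U z) s (V z)) → Translated (∃ₛ U) s (∃ₛ V)
ex-translated {V = V} T W =
  conseq (λ { _ ((z , u) , w) → z , u , w }) (ex (λ z → T z W)) post
  where
  post : ∃ₜ (λ z → Spec W (V z)) ⊨ₜ Spec W (∃ₛ V)
  post _ (z , sp) with spec⇒runs sp
  ... | w , σ , p , v = runs⇒spec (w , σ , p , z , v)

conseq-translated : ∀ {U U' Z Z' s} → U ⊨ₛ U' → Translated U' s Z' → Z' ⊨ₛ Z →
                    Translated U s Z
conseq-translated {Z = Z} {Z'} pre T post W =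
  conseq (λ { σ (u , w) → pre σ u , w }) (T W) weaken
  where
  weaken : Spec W Z' ⊨ₜ Spec W Z
  weaken _ sp with spec⇒runs sp
  ... | w , σ , p , z = runs⇒spec (w , σ , p , post σ z)

proposition4p2 : ∀ {s : Stmt} {U Z : SPred} → ⊢ₛ U s Z →
    ∀ (W : SPred) → ⊢ₜ (U ∧ₛ W) s (⟪ W ⟫ ** finite ** ⟪ Z ⟫)
proposition4p2 assign = assign-translated
proposition4p2 skip = skip-translated
proposition4p2 (seq d₀ d₁) = seq-translated (proposition4p2 d₀) (proposition4p2 d₁)
proposition4p2 (if dₜ d_f) = if-translated (proposition4p2 dₜ) (proposition4p2 d_f)
proposition4p2 (whilefun t m d) = whilefun-translated t m (λ n → proposition4p2 (d n))
proposition4p2 (ex d) = ex-translated (λ z → proposition4p2 (d z))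
proposition4p2 (conseq pre d post) =
  conseq-translated pre (proposition4p2 d) post
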